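{- Let $G$ be a connected graph with no false twin vertices and no dominating vertex, and let $\star G^k$ denote the $k$-th power of $G$ with respect to the co-normal product. Then $D'(\star G^k)=2$ for all $k\geq 3$. In particular, if $G$ is a rigid graph, then $D'(\star G^k)=2$ for all $k\geq 2$.
   Context: The co-normal product $G\star H$ of graphs $G,H$ has vertex set $V(G)\times V(H)$ and edge set $\{\{(x_1,x_2),(y_1,y_2)\} : x_1y_1\in E(G) \text{ or } x_2y_2\in E(H)\}$; $\star G^k$ is $G\star G\star\cdots\star G$ with $k$ factors. Two distinct vertices $u,v$ are false twins if $N(u)=N(v)$ (open neighborhoods). A dominating vertex is a vertex of degree $|V(G)|-1$. A graph is rigid if its automorphism group is trivial. The distinguishing index $D'(G)$ is the least integer $d$ such that $G$ has an edge labeling with $d$ labels preserved only by the trivial automorphism. -}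

module Defs where

open import Data.Nat using (ℕ; zero; suc; _<_)
open import Data.Fin using (Fin)
open import Data.Bool using (Bool; true; false; _∨_)
open import Data.Product using (_×_; _,_; Σ; ∃)
open import Data.Unit using (⊤; tt)
open import Relation.Binary.PropositionalEquality using (_≡_; _≢_)
open import Relation.Nullary using (¬_)

record Graph : Set₁ where
  field
    V      : Set
    adj    : V → V → Bool
    sym    : ∀ x y → adj x y ≡ adj y x
    irrefl : ∀ x → adj x x ≡ false
open Graph public

record FinGraph (n : ℕ) : Set where
  field
    adjF    : Fin n → Fin n → Bool
    symF    : ∀ x y → adjF x y ≡ adjF y x
    irreflF : ∀ x → adjF x x ≡ false
open FinGraph public

toGraph : ∀ {n} → FinGraph n → Graph
toGraph {n} G = record { V = Fin n ; adj = adjF G ; sym = symF G ; irrefl = irreflF G }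

_⋆_ : Graph → Graph → Graph
G ⋆ H = record
  { V = V G × V H
  ; adj = λ { (x1 , x2) (y1 , y2) → adj G x1 y1 ∨ adj H x2 y2 }
  ; sym = λ { (x1 , x2) (y1 , y2) → cong2∨ (sym G x1 y1) (sym H x2 y2) }
  ; irrefl = λ { (x1 , x2) → irr∨ (irrefl G x1) (irrefl H x2) }
  }
  where
  cong2∨ : ∀ {a b c d} → a ≡ c → b ≡ d → (a ∨ b) ≡ (c ∨ d)
  cong2∨ _≡_.refl _≡_.refl = _≡_.refl
  irr∨ : ∀ {a b} → a ≡ false → b ≡ false → (a ∨ b) ≡ false
  irr∨ _≡_.refl _≡_.refl = _≡_.refl

-- ⋆G^(k+1) = G ⋆ G ⋆ ... ⋆ G  (k+1 factors), bracketed to the right.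
pow⋆ : Graph → ℕ → Graph
pow⋆ G zero    = G
pow⋆ G (suc k) = G ⋆ pow⋆ G k

⋆^ : Graph → (k : ℕ) → 1 Data.Nat.≤ k → Graph
⋆^ G (suc k) _ = pow⋆ G k

record Automorphism (G : Graph) : Set where
  field
    f      : V G → V G
    g      : V G → V G
    fg     : ∀ x → f (g x) ≡ x
    gf     : ∀ x → g (f x) ≡ x
    pres   : ∀ x y → adj G (f x) (f y) ≡ adj G x y
open Automorphism public

IsTrivial : ∀ {G} → Automorphism G → Set
IsTrivial {G} σ = ∀ x → f σ x ≡ x

Rigid : Graph → Set
Rigid G = (σ : Automorphism G) → IsTrivial σ

-- An edge labeling with d labels: a label for every edge {x,y}
-- (given as a symmetric function; values on non-edges are irrelevant).
record EdgeLabeling (G : Graph) (d : ℕ) : Set where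
  field
    lab    : V G → V G → Fin d
    labSym : ∀ x y → lab x y ≡ lab y x
open EdgeLabeling public

Preserves : ∀ {G d} → Automorphism G → EdgeLabeling G d → Set
Preserves {G} σ c =
  ∀ x y → adj G x y ≡ true → lab c (f σ x) (f σ y) ≡ lab c x y

Distinguishing : ∀ {G d} → EdgeLabeling G d → Set
Distinguishing {G} c = (σ : Automorphism G) → Preserves σ c → IsTrivial σ

HasDistLabeling : Graph → ℕ → Set
HasDistLabeling G d = Σ (EdgeLabeling G d) Distinguishing

DistIndexIs : Graph → ℕ → Set
DistIndexIs G d = HasDistLabeling G d × (∀ e → e < d → ¬ HasDistLabeling G e)

data Reach (G : Graph) : V G → V G → Set where
  here : ∀ {x} → Reach G x x
  step : ∀ {x y z} → adj G x y ≡ true → Reach G y z → Reach G x z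

Connected : Graph → Set
Connected G = ∀ x y → Reach G x y

FalseTwins : (G : Graph) → V G → V G → Set
FalseTwins G u v = u ≢ v × (∀ w → adj G u w ≡ adj G v w)

NoFalseTwins : Graph → Set
NoFalseTwins G = ∀ u v → ¬ FalseTwins G u v

Dominating : (G : Graph) → V G → Set
Dominating G u = ∀ w → w ≢ u → adj G u w ≡ true

NoDominating : Graph → Set
NoDominating G = ∀ u → ¬ Dominating G u

-- Write ⋆G^k = G ⋆ H with H = ⋆G^(k-1). Exchanging the first two factors is a nontrivial
-- automorphism, so D' ≥ 2. For the upper bound take a maximal matching M of G and list V(H)
-- as c, p, …, q, d with d∼c, d∼q and c≁p; such vertices exist since G is connected, twin-free
-- and has no dominating vertex. For ab ∈ M traverse the rows {a , b} × V(H) by the zigzag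
-- (a,w₁), (b,w₁), (a,w₂), …, joining consecutive zigzags through d∼c; labelling exactly the
-- edges of this path by 1 gives the labeling. An automorphism preserving it maps the path
-- onto itself and cannot reverse it, as its two ends differ, so it fixes every matched row.
-- The unmatched vertices of G are independent, and neither G nor H has false twins, so
-- comparing neighbourhoods inside the fixed rows pins down every remaining vertex.
-- The argument works for k = 2 as well.
module Submission where

open import Defs hiding (sym)
open import Data.Bool using (true; false; _∨_) renaming (_≟_ to _≟ᵇ_)
open import Data.Bool.Properties
  using (∨-comm; ∨-assoc; ∨-identityʳ; ∨-zeroʳ; ∨-conicalˡ; ∨-conicalʳ; ¬-not)
open import Data.Empty using (⊥-elim)
open import Data.Fin using (Fin; zero; suc; fromℕ<)
import Data.Fin.Properties as Fin
open import Data.Fin.Properties using (any?; ¬∀⟶∃¬)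
open import Data.List using (List; []; _∷_; _++_; length; head; filter; allFin; cartesianProduct)
open import Data.List.Membership.Propositional using (_∈_; find)
open import Data.List.Membership.Propositional.Properties
  using (∈-++⁺ˡ; ∈-++⁺ʳ; ∈-++⁻; ∈-filter⁺; ∈-filter⁻; ∈-allFin; ∈-cartesianProduct⁺)
open import Data.List.Properties using (++-assoc; ++-identityʳ; length-++; length-filter)
open import Data.List.Relation.Unary.All as All using ()
open import Data.List.Relation.Unary.AllPairs using ([]; _∷_)
open import Data.List.Relation.Unary.Any as Any using (Any; here; there)
open import Data.List.Relation.Unary.Linked using (Linked; []; [-]; _∷_; _∷′_)
open import Data.List.Relation.Unary.Unique.Propositional using (Unique)
open import Data.List.Relation.Unary.Unique.Propositional.Properties
  using (++⁺; allFin⁺; filter⁺; cartesianProduct⁺)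
open import Data.Maybe using () renaming (just to some)
open import Data.Maybe.Relation.Binary.Connected using (just; just-nothing)
  renaming (Connected to MaybeConnected)
open import Data.Nat using (ℕ; zero; suc; _+_; _<_; _≤_; s≤s; z≤n)
open import Data.Nat.Properties
  using ( ≤-pred; ≤-trans; ≤-refl; <-trans; <-irrefl; n<1+n; ≤-antisym; ≮⇒≥; _<?_
        ; +-comm; +-identityʳ; anyUpTo?)
open import Data.Product using (∃-syntax; _×_; _,_; proj₁; proj₂)
open import Data.Product.Properties using (≡-dec)
open import Data.Sum using (_⊎_; inj₁; inj₂; swap)
open import Function using (_∘_)
open import Relation.Binary using (DecidableEquality)
open import Relation.Nullary using (Dec; yes; no; ¬_; contradiction)
open import Relation.Nullary.Decidable using (¬?; _×-dec_; _⊎-dec_; isYes)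
open import Relation.Unary using (Decidable)
open import Relation.Binary.PropositionalEquality
open ≡-Reasoning

nth : {A : Set} → A → List A → ℕ → A
nth d []       i       = d
nth d (x ∷ xs) zero    = x
nth d (x ∷ xs) (suc i) = nth d xs i

module _ {A : Set} (d : A) where

  nth-∈ : ∀ xs {i} → i < length xs → nth d xs i ∈ xs
  nth-∈ (x ∷ xs) {zero}  _       = here refl
  nth-∈ (x ∷ xs) {suc i} (s≤s p) = there (nth-∈ xs p)

  ∈⇒nth : ∀ {x} xs → x ∈ xs → ∃[ i ] i < length xs × nth d xs i ≡ x
  ∈⇒nth (y ∷ xs) (here refl) = zero , s≤s z≤n , refl
  ∈⇒nth (y ∷ xs) (there x∈xs) with ∈⇒nth xs x∈xs
  ... | i , i< , eq = suc i , s≤s i< , eq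

  nth-injective : ∀ {xs} → Unique xs → ∀ {i j} → i < length xs → j < length xs →
                  nth d xs i ≡ nth d xs j → i ≡ j
  nth-injective (_ ∷ _)      {zero}  {zero}  _       _       _  = refl
  nth-injective {x ∷ xs} (x∉ ∷ _) {zero}  {suc j} _       (s≤s j<) eq =
    ⊥-elim (All.lookup x∉ (nth-∈ xs j<) eq)
  nth-injective {x ∷ xs} (x∉ ∷ _) {suc i} {zero}  (s≤s i<) _       eq =
    ⊥-elim (All.lookup x∉ (nth-∈ xs i<) (sym eq))
  nth-injective (_ ∷ u)      {suc i} {suc j} (s≤s i<) (s≤s j<) eq =
    cong suc (nth-injective u i< j< eq)

  nth-++ : ∀ xs {ys} i → nth d (xs ++ ys) (length xs + i) ≡ nth d ys i
  nth-++ []       i = refl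
  nth-++ (x ∷ xs) i = nth-++ xs i

  nth-linked : ∀ {R : A → A → Set} {xs} → Linked R xs → ∀ {i} → suc i < length xs →
               R (nth d xs i) (nth d xs (suc i))
  nth-linked [-]       {i}     (s≤s ())
  nth-linked (r ∷ _)   {zero}  _       = r
  nth-linked (_ ∷ rs)  {suc i} (s≤s p) = nth-linked rs p

Neighbours : ℕ → ℕ → Set
Neighbours i j = suc i ≡ j ⊎ suc j ≡ i

neighbours-zero : ∀ {i} → Neighbours 0 i → i ≡ 1
neighbours-zero (inj₁ e) = sym e

module PathRigidity {V : Set} (at : ℕ → V) (m : ℕ)
  (at-injective : ∀ {i j} → i < 3 + m → j < 3 + m → at i ≡ at j → i ≡ j) where

  Step : V → V → Set
  Step u v = ∃[ i ] i < 2 + m × at i ≡ u × at (suc i) ≡ v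

  Adjacent : V → V → Set
  Adjacent u v = Step u v ⊎ Step v u

  adjacent⇒neighbours : ∀ {i j} → i < 3 + m → j < 3 + m →
                        Adjacent (at i) (at j) → Neighbours i j
  adjacent⇒neighbours i< j< (inj₁ (k , k< , eqₖ , eqₛₖ)) =
    inj₁ (trans (cong suc (at-injective i< (<-trans k< (n<1+n _)) (sym eqₖ)))
                (at-injective (s≤s k<) j< eqₛₖ))
  adjacent⇒neighbours i< j< (inj₂ (k , k< , eqₖ , eqₛₖ)) =
    inj₂ (trans (cong suc (at-injective j< (<-trans k< (n<1+n _)) (sym eqₖ)))
                (at-injective (s≤s k<) i< eqₛₖ))

  neighbours⇒adjacent : ∀ {i j} → i < 3 + m → j < 3 + m →
                        Neighbours i j → Adjacent (at i) (at j)
  neighbours⇒adjacent {i}     _  j< (inj₁ refl) = inj₁ (i , ≤-pred j< , refl , refl)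
  neighbours⇒adjacent {j = j} i< _  (inj₂ refl) = inj₂ (j , ≤-pred i< , refl , refl)

  adjacent⇒onPath : ∀ {u v} → Adjacent u v → ∃[ i ] i < 3 + m × at i ≡ u
  adjacent⇒onPath (inj₁ (k , k< , eqₖ , _))  = k , <-trans k< (n<1+n _) , eqₖ
  adjacent⇒onPath (inj₂ (k , k< , _ , eqₛₖ)) = suc k , s≤s k< , eqₛₖ

  neighbour : ∀ {i} → i < 3 + m → ∃[ j ] j < 3 + m × Neighbours i j
  neighbour {zero}  _  = 1 , s≤s (s≤s z≤n) , inj₁ refl
  neighbour {suc i} i< = i , <-trans (n<1+n i) i< , inj₂ refl

  module _ (f g : V → V) (f∘g : ∀ v → f (g v) ≡ v) (g∘f : ∀ v → g (f v) ≡ v)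
           (f-adjacent  : ∀ {u v} → Adjacent u v → Adjacent (f u) (f v))
           (f-adjacent⁻ : ∀ {u v} → Adjacent (f u) (f v) → Adjacent u v) where

    infix 4 _↦_
    _↦_ : ℕ → ℕ → Set
    i ↦ j = i < 3 + m × j < 3 + m × f (at i) ≡ at j

    image : ∀ {i} → i < 3 + m → ∃[ j ] i ↦ j
    image i< with neighbour i<
    ... | j , j< , ij with adjacent⇒onPath (f-adjacent (neighbours⇒adjacent i< j< ij))
    ... | k , k< , eq = k , i< , k< , sym eq

    preimage : ∀ {j} → j < 3 + m → ∃[ i ] i ↦ j
    preimage {j} j< with neighbour j<
    ... | k , k< , jk
      with adjacent⇒onPath (f-adjacent⁻ (subst₂ Adjacent (sym (f∘g (at j))) (sym (f∘g (at k)))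
                                                         (neighbours⇒adjacent j< k< jk)))
    ... | i , i< , eq = i , i< , j< , trans (cong f eq) (f∘g (at j))

    ↦-functional : ∀ {i j j′} → i ↦ j → i ↦ j′ → j ≡ j′
    ↦-functional (_ , j< , eq) (_ , j′< , eq′) = at-injective j< j′< (trans (sym eq) eq′)

    ↦-injective : ∀ {i i′ j} → i ↦ j → i′ ↦ j → i ≡ i′
    ↦-injective (i< , _ , eq) (i′< , _ , eq′) =
      at-injective i< i′< (trans (sym (g∘f _)) (trans (cong g (trans eq (sym eq′))) (g∘f _)))

    ↦-neighbours : ∀ {i i′ j j′} → i ↦ i′ → j ↦ j′ → Neighbours i j → Neighbours i′ j′
    ↦-neighbours (i< , i′< , eqᵢ) (j< , j′< , eqⱼ) ij =
      adjacent⇒neighbours i′< j′<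
        (subst₂ Adjacent eqᵢ eqⱼ (f-adjacent (neighbours⇒adjacent i< j< ij)))

    ↦-neighbours⁻ : ∀ {i i′ j j′} → i ↦ i′ → j ↦ j′ → Neighbours i′ j′ → Neighbours i j
    ↦-neighbours⁻ (i< , i′< , eqᵢ) (j< , j′< , eqⱼ) ij =
      adjacent⇒neighbours i< j<
        (f-adjacent⁻ (subst₂ Adjacent (sym eqᵢ) (sym eqⱼ) (neighbours⇒adjacent i′< j′< ij)))

    -- An interior image would have two neighbours, and both would have position 1 as preimage.
    endpoint↦endpoint : ∀ {j} → 0 ↦ j → j ≡ 0 ⊎ j ≡ 2 + m
    endpoint↦endpoint {zero}  _ = inj₁ refl
    endpoint↦endpoint {suc k} 0↦j@(_ , j< , _) with 2 + k <? 3 + m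
    ... | no  ¬2+k< = inj₂ (≤-antisym (≤-pred j<) (≤-pred (≮⇒≥ ¬2+k<)))
    ... | yes 2+k< with preimage (<-trans (n<1+n k) j<) | preimage 2+k<
    ... | i₁ , i₁↦k | i₂ , i₂↦2+k
      with neighbours-zero (↦-neighbours⁻ 0↦j i₁↦k (inj₂ refl))
         | neighbours-zero (↦-neighbours⁻ 0↦j i₂↦2+k (inj₁ refl))
    ... | refl | refl with ↦-functional i₁↦k i₂↦2+k
    ... | ()

    fixed-from-endpoint : 0 ↦ 0 → ∀ i → suc i < 3 + m → i ↦ i × suc i ↦ suc i
    fixed-from-endpoint 0↦0 zero 1< with image 1<
    ... | j , 1↦j with neighbours-zero (↦-neighbours 0↦0 1↦j (inj₁ refl))
    ... | refl = 0↦0 , 1↦j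
    fixed-from-endpoint 0↦0 (suc i) 2+i< with fixed-from-endpoint 0↦0 i (<-trans (n<1+n _) 2+i<)
    ... | i↦i , 1+i↦1+i with image 2+i<
    ... | j , 2+i↦j with ↦-neighbours 1+i↦1+i 2+i↦j (inj₁ refl)
    ... | inj₁ refl = 1+i↦1+i , 2+i↦j
    ... | inj₂ refl with ↦-injective i↦i 2+i↦j
    ... | ()

    reversed-from-endpoint : 0 ↦ 2 + m → 2 ↦ m
    reversed-from-endpoint 0↦last with image {1} (s≤s (s≤s z≤n)) | image {2} (s≤s (s≤s (s≤s z≤n)))
    ... | j₁ , 1↦j₁@(_ , j₁< , _) | j₂ , 2↦j₂ with ↦-neighbours 0↦last 1↦j₁ (inj₁ refl)
    ... | inj₁ refl = ⊥-elim (<-irrefl refl j₁<)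
    ... | inj₂ refl with ↦-neighbours 1↦j₁ 2↦j₂ (inj₁ refl)
    ... | inj₂ refl = 2↦j₂
    ... | inj₁ refl with ↦-injective 0↦last 2↦j₂
    ... | ()

    fixes-or-reverses : (∀ i → i < 3 + m → f (at i) ≡ at i)
                      ⊎ (f (at 0) ≡ at (2 + m) × f (at 2) ≡ at m)
    fixes-or-reverses with image {0} (s≤s z≤n)
    ... | j , 0↦j@(_ , _ , f0≡) with endpoint↦endpoint 0↦j
    ... | inj₁ refl = inj₁ fixed
      where
      fixed : ∀ i → i < 3 + m → f (at i) ≡ at i
      fixed zero    _  = f0≡
      fixed (suc i) i< with fixed-from-endpoint 0↦j i i<
      ... | _ , (_ , _ , eq) = eq
    ... | inj₂ refl with reversed-from-endpoint 0↦j
    ... | _ , _ , f2≡ = inj₂ (f0≡ , f2≡)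

label : {A : Set} → Dec A → Fin 2
label (yes _) = suc zero
label (no _)  = zero

label-yes : {A : Set} (a? : Dec A) → A → label a? ≡ suc zero
label-yes (yes _) _ = refl
label-yes (no ¬a) a = ⊥-elim (¬a a)

label≡1⇒ : {A : Set} (a? : Dec A) → label a? ≡ suc zero → A
label≡1⇒ (yes a) _ = a

label-cong : {A B : Set} → (A → B) → (B → A) → (a? : Dec A) (b? : Dec B) → label a? ≡ label b?
label-cong _   _   (yes _) (yes _) = refl
label-cong a→b _   (yes a) (no ¬b) = ⊥-elim (¬b (a→b a))
label-cong _   b→a (no ¬a) (yes b) = ⊥-elim (¬a (b→a b))
label-cong _   _   (no _)  (no _)  = refl

module PathLabeling (X : Graph) (_≟_ : DecidableEquality (V X)) (path : List (V X))
  (unique : Unique path) (walk : Linked (λ u v → adj X u v ≡ true) path)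
  {u₀ u₁ u₂ v₀ v₁ v₂ : V X} {rest pre : List (V X)}
  (starts : path ≡ u₀ ∷ u₁ ∷ u₂ ∷ rest) (ends : path ≡ pre ++ v₂ ∷ v₁ ∷ v₀ ∷ [])
  (u₀≁u₂ : adj X u₀ u₂ ≡ false) (v₀∼v₂ : adj X v₀ v₂ ≡ true) where

  m : ℕ
  m = length pre

  at : ℕ → V X
  at = nth u₀ path

  length-path : length path ≡ 3 + m
  length-path = trans (cong length ends) (trans (length-++ pre) (+-comm m 3))

  at-injective : ∀ {i j} → i < 3 + m → j < 3 + m → at i ≡ at j → i ≡ j
  at-injective i< j< = nth-injective u₀ unique (subst (_ <_) (sym length-path) i<)
                                                (subst (_ <_) (sym length-path) j<)

  open PathRigidity at m at-injective

  Step? : ∀ u v → Dec (Step u v)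
  Step? u v = anyUpTo? (λ i → (at i ≟ u) ×-dec (at (suc i) ≟ v)) (2 + m)

  labeling : EdgeLabeling X 2
  labeling = record
    { lab    = λ u v → label (Step? u v ⊎-dec Step? v u)
    ; labSym = λ u v → label-cong swap swap (Step? u v ⊎-dec Step? v u) (Step? v u ⊎-dec Step? u v)
    }

  step⇒adj : ∀ {u v} → Step u v → adj X u v ≡ true
  step⇒adj (i , i< , refl , refl) = nth-linked u₀ walk (subst (_ <_) (sym length-path) (s≤s i<))

  adjacent⇒adj : ∀ {u v} → Adjacent u v → adj X u v ≡ true
  adjacent⇒adj (inj₁ s) = step⇒adj s
  adjacent⇒adj {u} {v} (inj₂ s) = trans (Graph.sym X u v) (step⇒adj s)

  module _ (σ : Automorphism X) (preserves : Preserves σ labeling) where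

    preserves-adjacent : ∀ {u v} → Adjacent u v → Adjacent (f σ u) (f σ v)
    preserves-adjacent {u} {v} uv =
      label≡1⇒ (Step? (f σ u) (f σ v) ⊎-dec Step? (f σ v) (f σ u))
        (trans (preserves u v (adjacent⇒adj uv)) (label-yes (Step? u v ⊎-dec Step? v u) uv))

    reflects-adjacent : ∀ {u v} → Adjacent (f σ u) (f σ v) → Adjacent u v
    reflects-adjacent {u} {v} fufv =
      label≡1⇒ (Step? u v ⊎-dec Step? v u)
        (trans (sym (preserves u v (trans (sym (pres σ u v)) (adjacent⇒adj fufv))))
               (label-yes (Step? (f σ u) (f σ v) ⊎-dec Step? (f σ v) (f σ u)) fufv))

    not-reversed : ¬ (f σ (at 0) ≡ at (2 + m) × f σ (at 2) ≡ at m)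
    not-reversed (f0≡ , f2≡) with
      trans (sym u₀≁u₂) (trans (sym (pres σ u₀ u₂)) (trans (cong₂ (adj X) fu₀≡v₀ fu₂≡v₂) v₀∼v₂))
      where
      at-last≡v₀ : at (2 + m) ≡ v₀
      at-last≡v₀ = begin
        nth u₀ path (2 + m)                    ≡⟨ cong (nth u₀ path) (+-comm 2 m) ⟩
        nth u₀ path (m + 2)                    ≡⟨ cong (λ p → nth u₀ p (m + 2)) ends ⟩
        nth u₀ (pre ++ v₂ ∷ v₁ ∷ v₀ ∷ []) (m + 2) ≡⟨ nth-++ u₀ pre 2 ⟩
        v₀                                     ∎
      at-m≡v₂ : at m ≡ v₂
      at-m≡v₂ = begin
        nth u₀ path m                          ≡⟨ cong (nth u₀ path) (sym (+-identityʳ m)) ⟩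
        nth u₀ path (m + 0)                    ≡⟨ cong (λ p → nth u₀ p (m + 0)) ends ⟩
        nth u₀ (pre ++ v₂ ∷ v₁ ∷ v₀ ∷ []) (m + 0) ≡⟨ nth-++ u₀ pre 0 ⟩
        v₂                                     ∎
      fu₀≡v₀ : f σ u₀ ≡ v₀
      fu₀≡v₀ = trans (cong (λ p → f σ (nth u₀ p 0)) (sym starts)) (trans f0≡ at-last≡v₀)
      fu₂≡v₂ : f σ u₂ ≡ v₂
      fu₂≡v₂ = trans (cong (λ p → f σ (nth u₀ p 2)) (sym starts)) (trans f2≡ at-m≡v₂)
    ... | ()

    fixes-path : ∀ {v} → v ∈ path → f σ v ≡ v
    fixes-path v∈
      with fixes-or-reverses (f σ) (g σ) (fg σ) (gf σ) preserves-adjacent reflects-adjacent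
         | ∈⇒nth u₀ path v∈
    ... | inj₁ fixed   | i , i< , refl = fixed i (subst (_ <_) length-path i<)
    ... | inj₂ reverse | _             = ⊥-elim (not-reversed reverse)

adj⇒≢ : ∀ (G : Graph) {x y} → adj G x y ≡ true → x ≢ y
adj⇒≢ G {x} x∼y refl with trans (sym x∼y) (irrefl G x)
... | ()

TwinFree : Graph → Set
TwinFree X = ∀ u v → (∀ w → adj X u w ≡ adj X v w) → u ≡ v

noFalseTwins⇒twinFree : ∀ {n} (G : FinGraph n) → NoFalseTwins (toGraph G) → TwinFree (toGraph G)
noFalseTwins⇒twinFree G noTwins u v same with u Fin.≟ v
... | yes u≡v = u≡v
... | no  u≢v = ⊥-elim (noTwins u v (u≢v , same))

twinFree-⋆ : ∀ {G H} → TwinFree G → TwinFree H → TwinFree (G ⋆ H)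
twinFree-⋆ {G} {H} twinFreeG twinFreeH (x , h) (x′ , h′) same = cong₂ _,_ x≡x′ h≡h′
  where
  h′≁h : adj H h′ h ≡ false
  h′≁h = ∨-conicalʳ _ _ (trans (sym (same (x , h))) (cong₂ _∨_ (irrefl G x) (irrefl H h)))
  x≡x′ : x ≡ x′
  x≡x′ = twinFreeG x x′ λ t → begin
    adj G x t                  ≡⟨ sym (∨-identityʳ _) ⟩
    adj G x t ∨ false          ≡⟨ cong (adj G x t ∨_) (sym (irrefl H h)) ⟩
    adj G x t ∨ adj H h h      ≡⟨ same (t , h) ⟩
    adj G x′ t ∨ adj H h′ h    ≡⟨ cong (adj G x′ t ∨_) h′≁h ⟩
    adj G x′ t ∨ false         ≡⟨ ∨-identityʳ _ ⟩
    adj G x′ t                 ∎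
  h≡h′ : h ≡ h′
  h≡h′ = twinFreeH h h′ λ s → begin
    adj H h s                  ≡⟨ cong (_∨ adj H h s) (sym (irrefl G x)) ⟩
    adj G x x ∨ adj H h s      ≡⟨ same (x , s) ⟩
    adj G x′ x ∨ adj H h′ s    ≡⟨ cong (λ y → adj G y x ∨ adj H h′ s) (sym x≡x′) ⟩
    adj G x x ∨ adj H h′ s     ≡⟨ cong (_∨ adj H h′ s) (irrefl G x) ⟩
    adj H h′ s                 ∎

non-neighbour : ∀ {n} (G : FinGraph n) → NoDominating (toGraph G) →
                ∀ x → ∃[ z ] z ≢ x × adjF G x z ≡ false
non-neighbour {n} G noDom x with ¬∀⟶∃¬ n _ dominated? (noDom x)
  where
  dominated? : ∀ w → Dec (w ≢ x → adjF G x w ≡ true)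
  dominated? w with w Fin.≟ x | adjF G x w ≟ᵇ true
  ... | yes w≡x | _       = yes λ w≢x → contradiction w≡x w≢x
  ... | no  _   | yes x∼w = yes λ _ → x∼w
  ... | no  w≢x | no  x≁w = no λ dom → x≁w (dom w≢x)
... | z , ¬dom = z , (λ z≡x → ¬dom λ z≢x → contradiction z≡x z≢x) , ¬-not (λ x∼z → ¬dom λ _ → x∼z)

f-injective : ∀ {X} (σ : Automorphism X) {u v} → f σ u ≡ f σ v → u ≡ v
f-injective σ {u} {v} eq = trans (sym (gf σ u)) (trans (cong (g σ) eq) (gf σ v))

adj-fixed : ∀ {X} (σ : Automorphism X) {u} → f σ u ≡ u → ∀ v → adj X u v ≡ adj X u (f σ v)
adj-fixed {X} σ {u} fu≡u v = trans (sym (pres σ u v)) (cong (λ u′ → adj X u′ (f σ v)) fu≡u)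

module FixedCover {n} (G : FinGraph n) (H : Graph)
  (twinFreeG : TwinFree (toGraph G)) (noDom : NoDominating (toGraph G)) (twinFreeH : TwinFree H)
  {Cover : Fin n → Set} (Cover? : Decidable Cover)
  (independent : ∀ x y → ¬ Cover x → ¬ Cover y → adjF G x y ≡ false)
  (σ : Automorphism (toGraph G ⋆ H)) (fixes-cover : ∀ t w → Cover t → f σ (t , w) ≡ (t , w)) where

  X : Graph
  X = toGraph G ⋆ H

  uncovered-image : ∀ {x} w → ¬ Cover x → ¬ Cover (proj₁ (f σ (x , w)))
  uncovered-image {x} w x∉ covered =
    x∉ (subst Cover (cong proj₁ (f-injective σ (fixes-cover _ _ covered))) covered)

  -- Inside a fixed row t with x≁t, the neighbourhood of (x , w) is {t} × N_H(w).
  fixed-column : ∀ {t x} → (∀ s → f σ (t , s) ≡ (t , s)) → adjF G x t ≡ false →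
                 ∀ w → proj₂ (f σ (x , w)) ≡ w
  fixed-column {t} {x} row-fixed x≁t w = sym (twinFreeH w w′ λ s →
      trans (Graph.sym H w s) (trans (same s) (Graph.sym H s w′)))
    where
    x′ = proj₁ (f σ (x , w))
    w′ = proj₂ (f σ (x , w))
    seen : ∀ s → adj H s w ≡ adjF G t x′ ∨ adj H s w′
    seen s = trans (cong (_∨ adj H s w) (sym (trans (symF G t x) x≁t)))
                   (adj-fixed σ (row-fixed s) (x , w))
    t≁x′ : adjF G t x′ ≡ false
    t≁x′ = ∨-conicalˡ _ _ (sym (trans (sym (irrefl H w)) (seen w)))
    same : ∀ s → adj H s w ≡ adj H s w′
    same s = trans (seen s) (cong (_∨ adj H s w′) t≁x′)

  fixed-row : ∀ {x w} → ¬ Cover x → proj₂ (f σ (x , w)) ≡ w → proj₁ (f σ (x , w)) ≡ x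
  fixed-row {x} {w} x∉ w′≡w = sym (twinFreeG x x′ same)
    where
    x′ = proj₁ (f σ (x , w))
    same : ∀ s → adjF G x s ≡ adjF G x′ s
    same s with Cover? s
    ... | no  s∉ = trans (independent x s x∉ s∉) (sym (independent x′ s (uncovered-image w x∉) s∉))
    ... | yes s∈ = begin
      adjF G x s                     ≡⟨ symF G x s ⟩
      adjF G s x                     ≡⟨ sym (∨-identityʳ _) ⟩
      adjF G s x ∨ false             ≡⟨ cong (adjF G s x ∨_) (sym (irrefl H w)) ⟩
      adj X (s , w) (x , w)          ≡⟨ adj-fixed σ (fixes-cover s w s∈) (x , w) ⟩
      adjF G s x′ ∨ adj H w (proj₂ (f σ (x , w))) ≡⟨ cong (λ w′ → adjF G s x′ ∨ adj H w w′) w′≡w ⟩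
      adjF G s x′ ∨ adj H w w        ≡⟨ cong (adjF G s x′ ∨_) (irrefl H w) ⟩
      adjF G s x′ ∨ false            ≡⟨ ∨-identityʳ _ ⟩
      adjF G s x′                    ≡⟨ symF G s x′ ⟩
      adjF G x′ s                    ∎

  Anchored : Fin n → Set
  Anchored x = ∃[ t ] Cover t × adjF G x t ≡ false

  Anchored? : Decidable Anchored
  Anchored? x = any? λ t → Cover? t ×-dec (adjF G x t ≟ᵇ false)

  anchored-fixed : ∀ {x} → ¬ Cover x → Anchored x → ∀ w → f σ (x , w) ≡ (x , w)
  anchored-fixed x∉ (t , t∈ , x≁t) w = cong₂ _,_ (fixed-row x∉ w′≡w) w′≡w
    where
    w′≡w = fixed-column (λ s → fixes-cover t s t∈) x≁t w

  unanchored-adj : ∀ {x} → ¬ Cover x → ¬ Anchored x → ∀ s → adjF G x s ≡ isYes (Cover? s)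
  unanchored-adj {x} x∉ ¬anchored s with Cover? s
  ... | yes s∈ = ¬-not λ x≁s → ¬anchored (s , s∈ , x≁s)
  ... | no  s∉ = independent x s x∉ s∉

  unanchored-unique : ∀ {x y} → ¬ Cover x → ¬ Anchored x → ¬ Cover y → ¬ Anchored y → x ≡ y
  unanchored-unique x∉ x¬a y∉ y¬a =
    twinFreeG _ _ λ s → trans (unanchored-adj x∉ x¬a s) (sym (unanchored-adj y∉ y¬a s))

  fixes-all : ∀ v → f σ v ≡ v
  fixes-all (x , w) with Cover? x
  ... | yes x∈ = fixes-cover x w x∈
  ... | no  x∉ with Anchored? x
  ... | yes anchored = anchored-fixed x∉ anchored w
  ... | no  ¬anchored = cong₂ _,_ (fixed-row x∉ w′≡w) w′≡w
    where
    z = proj₁ (non-neighbour G noDom x)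
    z≢x = proj₁ (proj₂ (non-neighbour G noDom x))
    x≁z = proj₂ (proj₂ (non-neighbour G noDom x))
    z∉ : ¬ Cover z
    z∉ z∈ = ¬anchored (z , z∈ , x≁z)
    z-anchored : Anchored z
    z-anchored with Anchored? z
    ... | yes anchored = anchored
    ... | no  ¬anchoredᶻ = contradiction (unanchored-unique z∉ ¬anchoredᶻ x∉ ¬anchored) z≢x
    w′≡w = fixed-column (anchored-fixed z∉ z-anchored) x≁z w

module Matchings {n} (G : FinGraph n) where

  Matched : List (Fin n × Fin n) → Fin n → Set
  Matched ps x = Any (λ e → x ≡ proj₁ e ⊎ x ≡ proj₂ e) ps

  Matched? : ∀ ps → Decidable (Matched ps)
  Matched? ps x = Any.any? (λ e → (x Fin.≟ proj₁ e) ⊎-dec (x Fin.≟ proj₂ e)) ps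

  data Matching : List (Fin n × Fin n) → Set where
    []   : Matching []
    edge : ∀ {a b ps} → adjF G a b ≡ true → ¬ Matched ps a → ¬ Matched ps b →
           Matching ps → Matching ((a , b) ∷ ps)

  Maximal : List (Fin n × Fin n) → Set
  Maximal ps = ∀ x y → ¬ Matched ps x → ¬ Matched ps y → adjF G x y ≡ false

  record MaximalMatchingOn (cand : List (Fin n)) : Set where
    field
      pairs    : List (Fin n × Fin n)
      matching : Matching pairs
      within   : ∀ {x} → Matched pairs x → x ∈ cand
      maximal  : ∀ {x y} → x ∈ cand → y ∈ cand → ¬ Matched pairs x → ¬ Matched pairs y →
                 adjF G x y ≡ false

  greedy : ∀ fuel cand → Unique cand → length cand ≤ fuel → MaximalMatchingOn cand
  greedy _ [] _ _ = record { pairs = [] ; matching = [] ; within = λ () ; maximal = λ () }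
  greedy (suc fuel) (x ∷ xs) (x∉xs ∷ unique) (s≤s len≤) with Any.any? (λ y → adjF G x y ≟ᵇ true) xs
  ... | yes has-neighbour = record
    { pairs    = (x , y) ∷ pairs
    ; matching = edge x∼y x-free y-free matching
    ; within   = within′
    ; maximal  = maximal′
    }
    where
    y = proj₁ (find has-neighbour)
    y∈xs = proj₁ (proj₂ (find has-neighbour))
    x∼y = proj₂ (proj₂ (find has-neighbour))
    rest = filter (λ z → ¬? (z Fin.≟ y)) xs
    open MaximalMatchingOn (greedy fuel rest (filter⁺ _ unique) (≤-trans (length-filter _ xs) len≤))
    x-free : ¬ Matched pairs x
    x-free x-matched = All.lookup x∉xs (proj₁ (∈-filter⁻ _ (within x-matched))) refl
    y-free : ¬ Matched pairs y
    y-free y-matched = proj₂ (∈-filter⁻ _ {xs = xs} (within y-matched)) refl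
    within′ : ∀ {z} → Matched ((x , y) ∷ pairs) z → z ∈ x ∷ xs
    within′ (here (inj₁ refl)) = here refl
    within′ (here (inj₂ refl)) = there y∈xs
    within′ (there z-matched)  = there (proj₁ (∈-filter⁻ _ {xs = xs} (within z-matched)))
    remaining : ∀ {z} → z ∈ x ∷ xs → ¬ Matched ((x , y) ∷ pairs) z → z ∈ rest
    remaining (here refl) z-free = ⊥-elim (z-free (here (inj₁ refl)))
    remaining (there z∈)  z-free = ∈-filter⁺ _ z∈ λ z≡y → z-free (here (inj₂ z≡y))
    maximal′ : ∀ {z z′} → z ∈ x ∷ xs → z′ ∈ x ∷ xs → ¬ Matched ((x , y) ∷ pairs) z →
               ¬ Matched ((x , y) ∷ pairs) z′ → adjF G z z′ ≡ false
    maximal′ z∈ z′∈ z-free z′-free =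
      maximal (remaining z∈ z-free) (remaining z′∈ z′-free) (z-free ∘ there) (z′-free ∘ there)
  ... | no no-neighbour = record
    { pairs    = pairs
    ; matching = matching
    ; within   = there ∘ within
    ; maximal  = maximal′
    }
    where
    open MaximalMatchingOn (greedy fuel xs unique len≤)
    x≁ : ∀ {z} → z ∈ xs → adjF G x z ≡ false
    x≁ z∈ = ¬-not λ x∼z → no-neighbour (Any.map (λ { refl → x∼z }) z∈)
    maximal′ : ∀ {z z′} → z ∈ x ∷ xs → z′ ∈ x ∷ xs → ¬ Matched pairs z → ¬ Matched pairs z′ →
               adjF G z z′ ≡ false
    maximal′ (here refl) (here refl) _ _ = irreflF G x
    maximal′ (here refl) (there z′∈) _ _ = x≁ z′∈
    maximal′ {z} (there z∈) (here refl) _ _ = trans (symF G z x) (x≁ z∈)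
    maximal′ (there z∈) (there z′∈) z-free z′-free = maximal z∈ z′∈ z-free z′-free

  maximalMatching : ∃[ ps ] Matching ps × Maximal ps
  maximalMatching = pairs , matching , λ x y → maximal (∈-allFin x) (∈-allFin y)
    where open MaximalMatchingOn (greedy _ (allFin n) (allFin⁺ n) ≤-refl)

-- A listing of V H. Zigzag paths along it are joined through d∼c, and c≁p against d∼q
-- tells the two ends of the resulting path apart.
record Ordering (H : Graph) : Set where
  field
    c p q d  : V H
    middle   : List (V H)
    unique   : Unique (c ∷ p ∷ middle ++ q ∷ d ∷ [])
    complete : ∀ w → w ∈ c ∷ p ∷ middle ++ q ∷ d ∷ []
    d∼c      : adj H d c ≡ true
    c≁p      : adj H c p ≡ false
    d∼q      : adj H d q ≡ true

module ZigzagPath {n} (G : FinGraph n) (H : Graph) (O : Ordering H) where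
  open Ordering O
  open Matchings G

  X : Graph
  X = toGraph G ⋆ H

  order : List (V H)
  order = c ∷ p ∷ middle ++ q ∷ d ∷ []

  Edge : V X → V X → Set
  Edge u v = adj X u v ≡ true

  edgeˡ : ∀ {a b} → adjF G a b ≡ true → ∀ w w′ → Edge (a , w) (b , w′)
  edgeˡ a∼b w w′ = cong (_∨ adj H w w′) a∼b

  edgeʳ : ∀ a b {w w′} → adj H w w′ ≡ true → Edge (a , w) (b , w′)
  edgeʳ a b w∼w′ = trans (cong (adjF G a b ∨_) w∼w′) (∨-zeroʳ _)

  zigzag : Fin n → Fin n → List (V H) → List (V X)
  zigzag a b []       = []
  zigzag a b (w ∷ ws) = (a , w) ∷ (b , w) ∷ zigzag a b ws

  path : List (Fin n × Fin n) → List (V X)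
  path []             = []
  path ((a , b) ∷ ps) = zigzag a b order ++ path ps

  zigzag-++ : ∀ a b xs ys → zigzag a b (xs ++ ys) ≡ zigzag a b xs ++ zigzag a b ys
  zigzag-++ a b []       ys = refl
  zigzag-++ a b (x ∷ xs) ys = cong (λ zs → (a , x) ∷ (b , x) ∷ zs) (zigzag-++ a b xs ys)

  ∈-zigzag⁻ : ∀ {a b s w} ws → (s , w) ∈ zigzag a b ws → (s ≡ a ⊎ s ≡ b) × w ∈ ws
  ∈-zigzag⁻ (_ ∷ ws) (here refl)         = inj₁ refl , here refl
  ∈-zigzag⁻ (_ ∷ ws) (there (here refl)) = inj₂ refl , here refl
  ∈-zigzag⁻ (_ ∷ ws) (there (there s,w∈)) with ∈-zigzag⁻ ws s,w∈
  ... | s≡ , w∈ = s≡ , there w∈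

  ∈-zigzag⁺ : ∀ {a b s w} ws → s ≡ a ⊎ s ≡ b → w ∈ ws → (s , w) ∈ zigzag a b ws
  ∈-zigzag⁺ (_ ∷ ws) (inj₁ refl) (here refl) = here refl
  ∈-zigzag⁺ (_ ∷ ws) (inj₂ refl) (here refl) = there (here refl)
  ∈-zigzag⁺ (_ ∷ ws) s≡        (there w∈)  = there (there (∈-zigzag⁺ ws s≡ w∈))

  zigzag-unique : ∀ {a b} → a ≢ b → ∀ {ws} → Unique ws → Unique (zigzag a b ws)
  zigzag-unique a≢b {[]}     []          = []
  zigzag-unique {a} {b} a≢b {w ∷ ws} (w∉ws ∷ unique) =
    All.tabulate a,w∉ ∷ All.tabulate b,w∉ ∷ zigzag-unique a≢b unique
    where
    a,w∉ : ∀ {v} → v ∈ (b , w) ∷ zigzag a b ws → (a , w) ≢ v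
    a,w∉ (here refl)  eq   = a≢b (cong proj₁ eq)
    a,w∉ (there v∈)   refl = All.lookup w∉ws (proj₂ (∈-zigzag⁻ ws v∈)) refl
    b,w∉ : ∀ {v} → v ∈ zigzag a b ws → (b , w) ≢ v
    b,w∉ v∈ refl = All.lookup w∉ws (proj₂ (∈-zigzag⁻ ws v∈)) refl

  ∈-path⁻ : ∀ ps {s w} → (s , w) ∈ path ps → Matched ps s
  ∈-path⁻ ((a , b) ∷ ps) s,w∈ with ∈-++⁻ (zigzag a b order) s,w∈
  ... | inj₁ ∈zigzag = here (proj₁ (∈-zigzag⁻ order ∈zigzag))
  ... | inj₂ ∈path   = there (∈-path⁻ ps ∈path)

  ∈-path⁺ : ∀ ps {s} → Matched ps s → ∀ w → (s , w) ∈ path ps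
  ∈-path⁺ ((a , b) ∷ ps) (here s≡)       w = ∈-++⁺ˡ (∈-zigzag⁺ order s≡ (complete w))
  ∈-path⁺ ((a , b) ∷ ps) (there matched) w = ∈-++⁺ʳ (zigzag a b order) (∈-path⁺ ps matched w)

  path-unique : ∀ {ps} → Matching ps → Unique (path ps)
  path-unique []                              = []
  path-unique {(a , b) ∷ ps} (edge a∼b a-free b-free matching) =
    ++⁺ (zigzag-unique (adj⇒≢ (toGraph G) a∼b) unique) (path-unique matching) disjoint
    where
    disjoint : ∀ {v} → ¬ (v ∈ zigzag a b order × v ∈ path ps)
    disjoint (∈zigzag , ∈path) with proj₁ (∈-zigzag⁻ order ∈zigzag)
    ... | inj₁ refl = a-free (∈-path⁻ ps ∈path)
    ... | inj₂ refl = b-free (∈-path⁻ ps ∈path)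

  zigzag-linked : ∀ {a b} → adjF G a b ≡ true → ∀ ws {w rest} →
                  Linked Edge ((a , w) ∷ rest) → Linked Edge (zigzag a b ws ++ (a , w) ∷ rest)
  zigzag-linked a∼b []                    linked = linked
  zigzag-linked {a} {b} a∼b (w ∷ [])      linked =
    edgeˡ a∼b w w ∷ edgeˡ (trans (symF G b a) a∼b) w _ ∷ linked
  zigzag-linked {a} {b} a∼b (w ∷ ws@(w′ ∷ _)) linked =
    edgeˡ a∼b w w ∷ edgeˡ (trans (symF G b a) a∼b) w w′ ∷ zigzag-linked a∼b ws linked

  block-split : ∀ a b rest → zigzag a b order ++ rest
                           ≡ zigzag a b (c ∷ p ∷ middle ++ q ∷ []) ++ (a , d) ∷ (b , d) ∷ rest
  block-split a b rest = begin
    zigzag a b order ++ rest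
      ≡⟨ cong (λ ws → zigzag a b (c ∷ p ∷ ws) ++ rest) (sym (++-assoc middle (q ∷ []) (d ∷ []))) ⟩
    zigzag a b ((c ∷ p ∷ middle ++ q ∷ []) ++ d ∷ []) ++ rest
      ≡⟨ cong (_++ rest) (zigzag-++ a b (c ∷ p ∷ middle ++ q ∷ []) (d ∷ [])) ⟩
    (zigzag a b (c ∷ p ∷ middle ++ q ∷ []) ++ (a , d) ∷ (b , d) ∷ []) ++ rest
      ≡⟨ ++-assoc (zigzag a b (c ∷ p ∷ middle ++ q ∷ [])) _ rest ⟩
    zigzag a b (c ∷ p ∷ middle ++ q ∷ []) ++ (a , d) ∷ (b , d) ∷ rest ∎

  path-linked : ∀ {ps} → Matching ps → Linked Edge (path ps)
  path-linked [] = []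
  path-linked {(a , b) ∷ ps} (edge a∼b _ _ matching) =
    subst (Linked Edge) (sym (block-split a b (path ps)))
      (zigzag-linked a∼b (c ∷ p ∷ middle ++ q ∷ [])
        (edgeˡ a∼b d d ∷ (next ps ∷′ path-linked matching)))
    where
    next : ∀ ps′ → MaybeConnected Edge (some (b , d)) (head (path ps′))
    next []               = just-nothing
    next ((a′ , _) ∷ _)   = just (edgeʳ b a′ d∼c)

  path-ends : ∀ a b ps → ∃[ pre ] ∃[ a′ ] ∃[ b′ ]
              path ((a , b) ∷ ps) ≡ pre ++ (b′ , q) ∷ (a′ , d) ∷ (b′ , d) ∷ []
  path-ends a b [] = zigzag a b (c ∷ p ∷ middle) ++ (a , q) ∷ [] , a , b , (begin
    zigzag a b order ++ []
      ≡⟨ ++-identityʳ _ ⟩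
    zigzag a b order
      ≡⟨ zigzag-++ a b (c ∷ p ∷ middle) (q ∷ d ∷ []) ⟩
    zigzag a b (c ∷ p ∷ middle) ++ (a , q) ∷ _
      ≡⟨ sym (++-assoc (zigzag a b (c ∷ p ∷ middle)) _ _) ⟩
    (zigzag a b (c ∷ p ∷ middle) ++ (a , q) ∷ []) ++ _ ∎)
  path-ends a b ((a₁ , b₁) ∷ ps) with path-ends a₁ b₁ ps
  ... | pre , a′ , b′ , eq = zigzag a b order ++ pre , a′ , b′ ,
        trans (cong (zigzag a b order ++_) eq) (sym (++-assoc (zigzag a b order) pre _))

record Listing (A : Set) : Set where
  field
    elements : List A
    unique   : Unique elements
    complete : ∀ x → x ∈ elements

listing-Fin : ∀ n → Listing (Fin n)
listing-Fin n = record { elements = allFin n ; unique = allFin⁺ n ; complete = ∈-allFin }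

listing-× : ∀ {A B} → Listing A → Listing B → Listing (A × B)
listing-× LA LB = record
  { elements = cartesianProduct (Listing.elements LA) (Listing.elements LB)
  ; unique   = cartesianProduct⁺ (Listing.unique LA) (Listing.unique LB)
  ; complete = λ { (a , b) → ∈-cartesianProduct⁺ (Listing.complete LA a) (Listing.complete LB b) }
  }

record Quad (H : Graph) : Set where
  field
    c p q d : V H
    d∼c : adj H d c ≡ true
    d∼q : adj H d q ≡ true
    c≁p : adj H c p ≡ false
    c≢p : c ≢ p
    c≢q : c ≢ q
    p≢q : p ≢ q

quad-⋆ : ∀ {G H} → V G → Quad H → Quad (G ⋆ H)
quad-⋆ {G} {H} x Q = record
  { c = x , c ; p = x , p ; q = x , q ; d = x , d
  ; d∼c = trans (cong (_∨ adj H d c) (irrefl G x)) d∼c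
  ; d∼q = trans (cong (_∨ adj H d q) (irrefl G x)) d∼q
  ; c≁p = trans (cong (_∨ adj H c p) (irrefl G x)) c≁p
  ; c≢p = c≢p ∘ cong proj₂ ; c≢q = c≢q ∘ cong proj₂ ; p≢q = p≢q ∘ cong proj₂
  }
  where
  open Quad Q

ordering : ∀ {H} → DecidableEquality (V H) → Listing (V H) → Quad H → Ordering H
ordering {H} _≟_ L Q = record
  { c = c ; p = p ; q = q ; d = d ; middle = middle
  ; unique = All.tabulate c∉ ∷ All.tabulate p∉
             ∷ ++⁺ (filter⁺ Other? (Listing.unique L)) q,d-unique disjoint
  ; complete = complete
  ; d∼c = d∼c ; c≁p = c≁p ; d∼q = d∼q
  }
  where
  open Quad Q
  Other : V H → Set
  Other w = w ≢ c × w ≢ p × w ≢ q × w ≢ d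
  Other? = λ w → ¬? (w ≟ c) ×-dec ¬? (w ≟ p) ×-dec ¬? (w ≟ q) ×-dec ¬? (w ≟ d)
  middle = filter Other? (Listing.elements L)
  other : ∀ {w} → w ∈ middle → Other w
  other w∈ = proj₂ (∈-filter⁻ Other? {xs = Listing.elements L} w∈)
  c≢d = adj⇒≢ H d∼c ∘ sym
  q≢d = adj⇒≢ H d∼q ∘ sym
  p≢d : p ≢ d
  p≢d refl with trans (sym c≁p) (trans (Graph.sym H c d) d∼c)
  ... | ()
  tail-cases : ∀ {w} → w ∈ middle ++ q ∷ d ∷ [] → Other w ⊎ (w ≡ q ⊎ w ≡ d)
  tail-cases w∈ with ∈-++⁻ middle w∈
  ... | inj₁ w∈middle = inj₁ (other w∈middle)
  ... | inj₂ (here w≡q) = inj₂ (inj₁ w≡q)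
  ... | inj₂ (there (here w≡d)) = inj₂ (inj₂ w≡d)
  c∉ : ∀ {w} → w ∈ p ∷ middle ++ q ∷ d ∷ [] → c ≢ w
  c∉ (here refl) = c≢p
  c∉ (there w∈) with tail-cases w∈
  ... | inj₁ (w≢c , _)       = w≢c ∘ sym
  ... | inj₂ (inj₁ refl)     = c≢q
  ... | inj₂ (inj₂ refl)     = c≢d
  p∉ : ∀ {w} → w ∈ middle ++ q ∷ d ∷ [] → p ≢ w
  p∉ w∈ with tail-cases w∈
  ... | inj₁ (_ , w≢p , _)   = w≢p ∘ sym
  ... | inj₂ (inj₁ refl)     = p≢q
  ... | inj₂ (inj₂ refl)     = p≢d
  q,d-unique : Unique (q ∷ d ∷ [])
  q,d-unique = (q≢d All.∷ All.[]) ∷ All.[] ∷ []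
  disjoint : ∀ {w} → ¬ (w ∈ middle × w ∈ q ∷ d ∷ [])
  disjoint (w∈ , here refl)         = proj₁ (proj₂ (proj₂ (other w∈))) refl
  disjoint (w∈ , there (here refl)) = proj₂ (proj₂ (proj₂ (other w∈))) refl
  complete : ∀ w → w ∈ c ∷ p ∷ middle ++ q ∷ d ∷ []
  complete w with w ≟ c | w ≟ p | w ≟ q | w ≟ d
  ... | yes refl | _        | _        | _        = here refl
  ... | no  _    | yes refl | _        | _        = there (here refl)
  ... | no  _    | no  _    | yes refl | _        = there (there (∈-++⁺ʳ middle (here refl)))
  ... | no  _    | no  _    | no  _    | yes refl =
    there (there (∈-++⁺ʳ middle (there (here refl))))
  ... | no  w≢c  | no  w≢p  | no  w≢q  | no  w≢d  =
    there (there (∈-++⁺ˡ (∈-filter⁺ Other? (Listing.complete L w) (w≢c , w≢p , w≢q , w≢d))))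

module Powers (G : Graph) where

  pow-twinFree : TwinFree G → ∀ j → TwinFree (pow⋆ G j)
  pow-twinFree twinFree zero    = twinFree
  pow-twinFree twinFree (suc j) = twinFree-⋆ {G} {pow⋆ G j} twinFree (pow-twinFree twinFree j)

  pow-≟ : DecidableEquality (V G) → ∀ j → DecidableEquality (V (pow⋆ G j))
  pow-≟ _≟_ zero    = _≟_
  pow-≟ _≟_ (suc j) = ≡-dec _≟_ (pow-≟ _≟_ j)

  pow-listing : Listing (V G) → ∀ j → Listing (V (pow⋆ G j))
  pow-listing L zero    = L
  pow-listing L (suc j) = listing-× L (pow-listing L j)

  pow-quad : Quad G → ∀ j → Quad (pow⋆ G j)
  pow-quad Q zero    = Q
  pow-quad Q (suc j) = quad-⋆ (Quad.c Q) (pow-quad Q j)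

module QuadInGraph {n} (G : FinGraph n)
  (twinFree : TwinFree (toGraph G)) (noDom : NoDominating (toGraph G)) where

  FreeFrom : Fin n → Fin n → Fin n → Set
  FreeFrom x y z = adjF G x z ≡ false × z ≢ x × z ≢ y

  FreeFrom? : ∀ x y z → Dec (FreeFrom x y z)
  FreeFrom? x y z = (adjF G x z ≟ᵇ false) ×-dec ¬? (z Fin.≟ x) ×-dec ¬? (z Fin.≟ y)

  path-of-length-two : ∀ {s e} → Reach (toGraph G) s e → s ≢ e → adjF G s e ≡ false →
                       ∃[ u ] ∃[ v ] ∃[ w ] adjF G u v ≡ true × adjF G v w ≡ true × u ≢ w
  path-of-length-two here s≢e _ = contradiction refl s≢e
  path-of-length-two (step s∼e here) _ s≁e with trans (sym s∼e) s≁e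
  ... | ()
  path-of-length-two {s} (step {y = y} s∼y (step {y = z} y∼z walk)) s≢e s≁e with z Fin.≟ s
  ... | yes refl = path-of-length-two walk s≢e s≁e
  ... | no  z≢s  = s , y , z , s∼y , y∼z , λ s≡z → z≢s (sym s≡z)

  quad-of-path : ∀ {u v w} → adjF G u v ≡ true → adjF G v w ≡ true → u ≢ w → Quad (toGraph G)
  quad-of-path {u} {v} {w} u∼v v∼w u≢w with any? (FreeFrom? u w) | any? (FreeFrom? w u)
  ... | yes (z , u≁z , z≢u , z≢w) | _ = record
    { c = u ; p = z ; q = w ; d = v
    ; d∼c = trans (symF G v u) u∼v ; d∼q = v∼w ; c≁p = u≁z
    ; c≢p = λ u≡z → z≢u (sym u≡z) ; c≢q = u≢w ; p≢q = z≢w }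
  ... | no _ | yes (z , w≁z , z≢w , z≢u) = record
    { c = w ; p = z ; q = u ; d = v
    ; d∼c = v∼w ; d∼q = trans (symF G v u) u∼v ; c≁p = w≁z
    ; c≢p = λ w≡z → z≢w (sym w≡z) ; c≢q = λ w≡u → u≢w (sym w≡u) ; p≢q = z≢u }
  ... | no ¬free-u | no ¬free-w with adjF G u w in u?w
  ... | true  = ⊥-elim (noDom u dominating)
    where
    dominating : Dominating (toGraph G) u
    dominating z z≢u with z Fin.≟ w
    ... | yes refl = u?w
    ... | no  z≢w  = ¬-not λ u≁z → ¬free-u (z , u≁z , z≢u , z≢w)
  ... | false = ⊥-elim (u≢w (twinFree u w twins))
    where
    twins : ∀ s → adjF G u s ≡ adjF G w s
    twins s with s Fin.≟ u | s Fin.≟ w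
    ... | yes refl | _        = trans (irreflF G u) (sym (trans (symF G w u) u?w))
    ... | no  _    | yes refl = trans u?w (sym (irreflF G w))
    ... | no  s≢u  | no  s≢w  = trans (¬-not λ u≁s → ¬free-u (s , u≁s , s≢u , s≢w))
                                      (sym (¬-not λ w≁s → ¬free-w (s , w≁s , s≢w , s≢u)))

  quad : Fin n → Connected (toGraph G) → Quad (toGraph G)
  quad x connected with non-neighbour G noDom x
  ... | z , z≢x , x≁z with path-of-length-two (connected x z) (λ x≡z → z≢x (sym x≡z)) x≁z
  ... | _ , _ , _ , u∼v , v∼w , u≢w = quad-of-path u∼v v∼w u≢w

fin1-unique : ∀ (i j : Fin 1) → i ≡ j
fin1-unique zero zero = refl

lower-bound : ∀ {X} → V X → (σ : Automorphism X) → ¬ IsTrivial σ →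
              ∀ e → e < 2 → ¬ HasDistLabeling X e
lower-bound x _ _          zero          _ (c , _) with lab c x x
... | ()
lower-bound _ σ nontrivial (suc zero)    _ (_ , distinguishing) =
  nontrivial (distinguishing σ λ _ _ _ → fin1-unique _ _)
lower-bound _ _ _          (suc (suc _)) (s≤s (s≤s ()))

module FactorSwap (G : Graph) where

  ∨-swap : ∀ a b r → (a ∨ (b ∨ r)) ≡ (b ∨ (a ∨ r))
  ∨-swap a b r = trans (sym (∨-assoc a b r)) (trans (cong (_∨ r) (∨-comm a b)) (∨-assoc b a r))

  swap-automorphism : ∀ j → Automorphism (G ⋆ pow⋆ G j)
  swap-automorphism zero = record
    { f = λ { (x , y) → y , x } ; g = λ { (x , y) → y , x } ; fg = λ _ → refl ; gf = λ _ → refl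
    ; pres = λ { (x , y) (x′ , y′) → ∨-comm (adj G y y′) (adj G x x′) } }
  swap-automorphism (suc j) = record
    { f = λ { (x , y , r) → y , x , r } ; g = λ { (x , y , r) → y , x , r }
    ; fg = λ _ → refl ; gf = λ _ → refl
    ; pres = λ { (x , y , r) (x′ , y′ , r′) →
               ∨-swap (adj G y y′) (adj G x x′) (adj (pow⋆ G j) r r′) } }

  diagonal : V G → ∀ j → V (pow⋆ G j)
  diagonal x zero    = x
  diagonal x (suc j) = x , diagonal x j

  swap-nontrivial : ∀ {x y} → x ≢ y → ∀ j → ¬ IsTrivial (swap-automorphism j)
  swap-nontrivial {x} {y} x≢y zero    trivial = x≢y (cong proj₁ (sym (trivial (x , y))))
  swap-nontrivial {x} {y} x≢y (suc j) trivial =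
    x≢y (cong proj₁ (sym (trivial (x , y , diagonal y j))))

upper-bound : ∀ {n} (G : FinGraph n) → TwinFree (toGraph G) → NoDominating (toGraph G) →
              ∀ {a b} → adjF G a b ≡ true →
              (H : Graph) → TwinFree H → DecidableEquality (V H) → Ordering H →
              HasDistLabeling (toGraph G ⋆ H) 2
upper-bound G twinFreeG noDom {a} {b} a∼b H twinFreeH _≟_ O with Matchings.maximalMatching G
... | [] , _ , maximal with trans (sym a∼b) (maximal a b (λ ()) (λ ()))
... | ()
upper-bound G twinFreeG noDom a∼b H twinFreeH _≟_ O | (a₁ , b₁) ∷ ps , matching , maximal
  with ZigzagPath.path-ends G H O a₁ b₁ ps
... | pre , a′ , b′ , ends = L.labeling , distinguishing
  where
  open Ordering O
  open Matchings G
  open ZigzagPath G H O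
  module L = PathLabeling X (≡-dec Fin._≟_ _≟_) (path ((a₁ , b₁) ∷ ps))
    (path-unique matching) (path-linked matching) refl ends
    (trans (cong (_∨ adj H c p) (irreflF G a₁)) c≁p)
    (trans (cong (_∨ adj H d q) (irreflF G b′)) d∼q)
  distinguishing : Distinguishing L.labeling
  distinguishing σ preserving =
    FixedCover.fixes-all G H twinFreeG noDom twinFreeH (Matched? _) maximal σ
      λ t w t-matched → L.fixes-path σ preserving (∈-path⁺ _ t-matched w)

distinguishing-index : ∀ {n} (G : FinGraph n) → Fin n → Connected (toGraph G) →
                       TwinFree (toGraph G) → NoDominating (toGraph G) →
                       ∀ j → DistIndexIs (toGraph G ⋆ pow⋆ (toGraph G) j) 2
distinguishing-index {n} G x connected twinFree noDom j =
  upper-bound G twinFree noDom (Quad.d∼c Q)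
    (pow⋆ (toGraph G) j) (pow-twinFree twinFree j) (pow-≟ Fin._≟_ j)
    (ordering (pow-≟ Fin._≟_ j) (pow-listing (listing-Fin n) j) (pow-quad Q j))
  , lower-bound (x , diagonal x j) (swap-automorphism j)
                (swap-nontrivial (proj₁ (proj₂ (non-neighbour G noDom x))) j)
  where
  open Powers (toGraph G)
  open FactorSwap (toGraph G)
  Q = QuadInGraph.quad G twinFree noDom x connected

mainTheorem6 : ∀ {n} (G : FinGraph n) → 0 < n
    → Connected (toGraph G) → NoFalseTwins (toGraph G) → NoDominating (toGraph G)
    → ((k : ℕ) → (hk : 3 ≤ k) → DistIndexIs (⋆^ (toGraph G) k (≤-trans (s≤s z≤n) hk)) 2)
      × (Rigid (toGraph G) → (k : ℕ) → (hk : 2 ≤ k) → DistIndexIs (⋆^ (toGraph G) k (≤-trans (s≤s z≤n) hk)) 2)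
mainTheorem6 G 0<n connected noFalseTwins noDom = power≥3 , λ _ → power≥2
  where
  index : ∀ j → DistIndexIs (toGraph G ⋆ pow⋆ (toGraph G) j) 2
  index = distinguishing-index G (fromℕ< 0<n) connected (noFalseTwins⇒twinFree G noFalseTwins) noDom
  power≥3 : (k : ℕ) → (hk : 3 ≤ k) → DistIndexIs (⋆^ (toGraph G) k (≤-trans (s≤s z≤n) hk)) 2
  power≥3 (suc (suc (suc k))) (s≤s (s≤s (s≤s _))) = index (suc k)
  power≥2 : (k : ℕ) → (hk : 2 ≤ k) → DistIndexIs (⋆^ (toGraph G) k (≤-trans (s≤s z≤n) hk)) 2
  power≥2 (suc (suc k)) (s≤s (s≤s _)) = index k
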